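{- Let $a,b$ be different digits from $\{1,3,7,9\}$ and let $n\ge 2$ be such that $B_n(a,b)$ is an absolute prime. Let $p$ be a prime with $n>p-1$ such that $10$ is a primitive root modulo $p$ and $\gcd(a,p)=1$. Then $n$ is a multiple of $p-1$.
   Context: An absolute prime is a positive integer which is prime and remains prime after an arbitrary permutation of the digits of its decimal representation. $A_n=(10^n-1)/9$ is the repunit with $n$ decimal digits equal to $1$, and $B_n(a,b)=a\cdot A_n+(b-a)$ is the $n$-digit number whose decimal representation consists of $n-1$ digits $a$ followed by a final digit $b$. The integer $10$ is a primitive root modulo the prime $p$ if the least positive $h$ with $10^h\equiv 1\pmod p$ equals $p-1$. -}

module Defs where

open import Data.Nat using (ℕ; zero; suc; _+_; _*_; _∸_; _^_; _≤_; _<_; NonZero; s≤s; z≤n)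
open import Data.Nat.DivMod using (_/_; _%_; m/n<m)
open import Data.Nat.Primality using (Prime)
open import Data.List using (List; []; _∷_; _++_; foldl)
open import Data.List.Relation.Binary.Permutation.Propositional using (_↭_)
open import Data.Product using (_×_)
open import Relation.Binary.PropositionalEquality using (_≡_)
open import Relation.Nullary using (¬_)
open import Induction.WellFounded using (Acc; acc)
open import Data.Nat.Induction using (<-wellFounded)

A : ℕ → ℕ
A n = (10 ^ n ∸ 1) / 9

-- B_n(a,b) = a * A_n + (b - a), computed as a*A_n + b - a (nonnegative since a*A_n ≥ a for n ≥ 1)
B : ℕ → ℕ → ℕ → ℕ
B n a b = a * A n + b ∸ a

-- decimal digits, most significant first (digits 0 = [])
digitsAcc : (m : ℕ) → Acc _<_ m → List ℕ
digitsAcc zero _ = []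
digitsAcc (suc k) (acc rs) =
  digitsAcc (suc k / 10) (rs (m/n<m (suc k) 10 (s≤s (s≤s z≤n))))
    ++ (suc k % 10 ∷ [])

digits : ℕ → List ℕ
digits m = digitsAcc m (<-wellFounded m)

fromDigits : List ℕ → ℕ
fromDigits = foldl (λ acc d → 10 * acc + d) 0

AbsolutePrime : ℕ → Set
AbsolutePrime m = Prime m × (∀ (ds : List ℕ) → ds ↭ digits m → Prime (fromDigits ds))

TenPrimitiveRoot : (p : ℕ) → .{{NonZero p}} → Set
TenPrimitiveRoot p = (10 ^ (p ∸ 1) % p ≡ 1 % p)
  × (∀ h → 0 < h → h < p ∸ 1 → ¬ (10 ^ h % p ≡ 1 % p))

{-# OPTIONS --safe #-}
module Submission where

-- Let N = a·A_n. If p ∣ N then p ∣ A_n (as p ∤ a), so 10^n ≡ 1 (mod p) and the order p - 1 of 10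
-- divides n. Otherwise, moving the last digit b of B_n(a,b) to the position of weight 10^k gives a
-- permutation X ≡ N - (a - b)·10^k (mod p). Here p ∤ a - b, since |a - b| divides 24 while p ∤ 10
-- and p ≠ 3 (10 has order 1 mod 3). As 10 is a primitive root, the residues (a - b)·10^k with
-- k < p - 1 are all the nonzero residues, so some k < p - 1 < n makes p ∣ X. But X is prime and
-- X ≥ A_n > n ≥ p.

open import Defs
open import Data.Fin as Fin using (Fin; zero; toℕ; punchOut)
open import Data.Fin.Properties
  using (any?; injective⇒≤; punchOut-injective; toℕ-fromℕ<; toℕ-injective; toℕ<n)
open import Data.List using (List; []; _∷_; _++_; _∷ʳ_; foldl; length; replicate)
open import Data.List.Membership.Propositional using (_∈_)
open import Data.List.Properties using (foldl-++; foldl-∷ʳ; length-++; length-replicate)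
open import Data.List.Relation.Binary.Permutation.Propositional using (_↭_; module PermutationReasoning)
open import Data.List.Relation.Binary.Permutation.Propositional.Properties using (shift; ∷↭∷ʳ)
open import Data.List.Relation.Unary.All as All using (All; []; _∷_)
open import Data.List.Relation.Unary.All.Properties using (∷ʳ⁻; ∷ʳ⁺; ++⁺; replicate⁺)
open import Data.List.Reverse using (Reverse; []; _∶_∶ʳ_; reverseView)
open import Data.Nat
open import Data.Nat.Coprimality as Coprime using (coprime-divisor; gcd≡1⇒coprime)
open import Data.Nat.Divisibility
  using ( _∣_; _∣?_; _∤_; divides; hasNonTrivialDivisor; ∣-refl; ∣-trans; m∣m*n; n∣m*n; ∣n⇒∣m*n
        ; ∣1⇒≡1; m%n≡0⇒n∣m; n∣m⇒m%n≡0)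
open import Data.Nat.DivMod
open import Data.Nat.GCD using (gcd)
open import Data.Nat.Induction using (<-wellFounded)
open import Data.Nat.Primality
  using (Prime; prime?; euclidsLemma; prime⇒nonZero; prime⇒nonTrivial; prime⇒irreducible)
open import Data.Nat.Properties
open import Data.Nat.Tactic.RingSolver using (solve-∀)
open import Data.Product using (_×_; _,_; ∃; proj₁; proj₂)
open import Data.Sum using (_⊎_; inj₁; inj₂; [_,_]′)
open import Function using (id; _∘_)
open import Function.Definitions using (Injective; StrictlySurjective)
open import Induction.WellFounded using (Acc; acc)
open import Relation.Binary.PropositionalEquality
open import Relation.Nullary using (¬_; yes; no; contradiction)
open import Relation.Nullary.Decidable using (from-yes; _×-dec_; _⊎-dec_)

pushDigit : ℕ → ℕ → ℕ
pushDigit n d = 10 * n + d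

foldl-pushDigit : ∀ c ds → foldl pushDigit c ds ≡ c * 10 ^ length ds + fromDigits ds
foldl-pushDigit c [] = sym (trans (+-identityʳ (c * 1)) (*-identityʳ c))
foldl-pushDigit c (d ∷ ds) = begin
  foldl pushDigit (10 * c + d) ds                  ≡⟨ foldl-pushDigit (10 * c + d) ds ⟩
  (10 * c + d) * 10 ^ length ds + fromDigits ds    ≡⟨ regroup c d (10 ^ length ds) (fromDigits ds) ⟩
  c * 10 ^ suc (length ds) + (d * 10 ^ length ds + fromDigits ds)
    ≡⟨ cong (c * 10 ^ suc (length ds) +_) (foldl-pushDigit d ds) ⟨
  c * 10 ^ suc (length ds) + foldl pushDigit d ds  ∎
  where
  open ≡-Reasoning
  regroup : ∀ c d t f → (10 * c + d) * t + f ≡ c * (10 * t) + (d * t + f)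
  regroup = solve-∀

fromDigits-∷ : ∀ d ds → fromDigits (d ∷ ds) ≡ d * 10 ^ length ds + fromDigits ds
fromDigits-∷ = foldl-pushDigit

fromDigits-++ : ∀ xs ys → fromDigits (xs ++ ys) ≡ fromDigits xs * 10 ^ length ys + fromDigits ys
fromDigits-++ xs ys = trans (foldl-++ pushDigit 0 xs ys) (foldl-pushDigit (fromDigits xs) ys)

fromDigits-replaceDigit : ∀ xs a b ys →
  fromDigits (xs ++ b ∷ ys) + a * 10 ^ length ys ≡ fromDigits (xs ++ a ∷ ys) + b * 10 ^ length ys
fromDigits-replaceDigit xs a b ys = begin
  fromDigits (xs ++ b ∷ ys) + a * t                   ≡⟨ cong (_+ a * t) (expand b) ⟩
  fromDigits xs * 10 ^ length (b ∷ ys) + (b * t + fromDigits ys) + a * t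
    ≡⟨ swap (fromDigits xs * 10 ^ length (b ∷ ys)) a b t (fromDigits ys) ⟩
  fromDigits xs * 10 ^ length (a ∷ ys) + (a * t + fromDigits ys) + b * t
    ≡⟨ cong (_+ b * t) (expand a) ⟨
  fromDigits (xs ++ a ∷ ys) + b * t                   ∎
  where
  open ≡-Reasoning
  t : ℕ
  t = 10 ^ length ys
  expand : ∀ c → fromDigits (xs ++ c ∷ ys) ≡ fromDigits xs * 10 ^ length (c ∷ ys) + (c * t + fromDigits ys)
  expand c = trans (fromDigits-++ xs (c ∷ ys)) (cong (fromDigits xs * 10 ^ length (c ∷ ys) +_) (fromDigits-∷ c ys))
  swap : ∀ u a b t f → u + (b * t + f) + a * t ≡ u + (a * t + f) + b * t
  swap = solve-∀

repunit : ℕ → ℕ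
repunit zero    = 0
repunit (suc n) = 10 ^ n + repunit n

9*repunit+1≡10^n : ∀ n → 9 * repunit n + 1 ≡ 10 ^ n
9*repunit+1≡10^n zero    = refl
9*repunit+1≡10^n (suc n) = begin
  9 * (10 ^ n + repunit n) + 1    ≡⟨ regroup (10 ^ n) (repunit n) ⟩
  9 * 10 ^ n + (9 * repunit n + 1) ≡⟨ cong (9 * 10 ^ n +_) (9*repunit+1≡10^n n) ⟩
  9 * 10 ^ n + 10 ^ n             ≡⟨ nine-plus-one (10 ^ n) ⟩
  10 * 10 ^ n                     ∎
  where
  open ≡-Reasoning
  regroup : ∀ t r → 9 * (t + r) + 1 ≡ 9 * t + (9 * r + 1)
  regroup = solve-∀
  nine-plus-one : ∀ t → 9 * t + t ≡ 10 * t
  nine-plus-one = solve-∀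

A≡repunit : ∀ n → A n ≡ repunit n
A≡repunit n = begin
  (10 ^ n ∸ 1) / 9                ≡⟨ cong (λ x → (x ∸ 1) / 9) (9*repunit+1≡10^n n) ⟨
  (9 * repunit n + 1 ∸ 1) / 9     ≡⟨ cong (_/ 9) (m+n∸n≡m (9 * repunit n) 1) ⟩
  9 * repunit n / 9               ≡⟨ cong (_/ 9) (*-comm 9 (repunit n)) ⟩
  repunit n * 9 / 9               ≡⟨ m*n/n≡m (repunit n) 9 ⟩
  repunit n                       ∎
  where open ≡-Reasoning

fromDigits-replicate : ∀ n a → fromDigits (replicate n a) ≡ a * repunit n
fromDigits-replicate zero    a = sym (*-zeroʳ a)
fromDigits-replicate (suc n) a = begin
  fromDigits (a ∷ replicate n a)                            ≡⟨ fromDigits-∷ a (replicate n a) ⟩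
  a * 10 ^ length (replicate n a) + fromDigits (replicate n a)
    ≡⟨ cong₂ (λ l f → a * 10 ^ l + f) (length-replicate n) (fromDigits-replicate n a) ⟩
  a * 10 ^ n + a * repunit n                                ≡⟨ *-distribˡ-+ a (10 ^ n) (repunit n) ⟨
  a * (10 ^ n + repunit n)                                  ∎
  where open ≡-Reasoning

repunit-≤-fromDigits : ∀ {ds} → All (1 ≤_) ds → repunit (length ds) ≤ fromDigits ds
repunit-≤-fromDigits [] = z≤n
repunit-≤-fromDigits {d ∷ ds} (1≤d ∷ 1≤ds) = begin
  10 ^ length ds + repunit (length ds)    ≡⟨ cong (_+ repunit (length ds)) (*-identityˡ (10 ^ length ds)) ⟨
  1 * 10 ^ length ds + repunit (length ds)
    ≤⟨ +-mono-≤ (*-monoˡ-≤ (10 ^ length ds) 1≤d) (repunit-≤-fromDigits 1≤ds) ⟩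
  d * 10 ^ length ds + fromDigits ds      ≡⟨ fromDigits-∷ d ds ⟨
  fromDigits (d ∷ ds)                     ∎
  where open ≤-Reasoning

n≤repunit : ∀ n → n ≤ repunit n
n≤repunit zero    = z≤n
n≤repunit (suc n) = +-mono-≤ (m^n>0 10 n) (n≤repunit n)

n<repunit : ∀ {n} → 2 ≤ n → n < repunit n
n<repunit {suc (suc n)} (s≤s (s≤s _)) =
  +-mono-≤ {2} (≤-trans (s≤s (s≤s z≤n)) (*-monoʳ-≤ 10 (m^n>0 10 n))) (n≤repunit (suc n))

digitsAcc-irrelevant : ∀ x (r s : Acc _<_ x) → digitsAcc x r ≡ digitsAcc x s
digitsAcc-irrelevant zero    _        _        = refl
digitsAcc-irrelevant (suc x) (acc rs) (acc ss) =
  cong (_∷ʳ suc x % 10) (digitsAcc-irrelevant (suc x / 10) (rs x/10<x) (ss x/10<x))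
  where
  x/10<x : suc x / 10 < suc x
  x/10<x = m/n<m (suc x) 10 (s≤s (s≤s z≤n))

digits-suc : ∀ x → digits (suc x) ≡ digits (suc x / 10) ∷ʳ suc x % 10
digits-suc x = unfold (<-wellFounded (suc x))
  where
  unfold : (r : Acc _<_ (suc x)) → digitsAcc (suc x) r ≡ digits (suc x / 10) ∷ʳ suc x % 10
  unfold (acc rs) = cong (_∷ʳ suc x % 10)
    (digitsAcc-irrelevant (suc x / 10) (rs (m/n<m (suc x) 10 (s≤s (s≤s z≤n)))) (<-wellFounded (suc x / 10)))

digits-snoc : ∀ x {d} → 0 < d → d < 10 → digits (10 * x + d) ≡ digits x ∷ʳ d
digits-snoc x {suc d} _ d<10 = begin
  digits (10 * x + suc d)                       ≡⟨ cong digits (+-suc (10 * x) d) ⟩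
  digits (suc (10 * x + d))                     ≡⟨ digits-suc (10 * x + d) ⟩
  digits (suc (10 * x + d) / 10) ∷ʳ suc (10 * x + d) % 10
    ≡⟨ cong₂ (λ q r → digits q ∷ʳ r) quotient remainder ⟩
  digits x ∷ʳ suc d                             ∎
  where
  open ≡-Reasoning
  shape : suc (10 * x + d) ≡ suc d + x * 10
  shape = trans (sym (+-suc (10 * x) d)) (trans (+-comm (10 * x) (suc d)) (cong (suc d +_) (*-comm 10 x)))
  quotient : suc (10 * x + d) / 10 ≡ x
  quotient = begin
    suc (10 * x + d) / 10      ≡⟨ /-congˡ {o = 10} shape ⟩
    (suc d + x * 10) / 10      ≡⟨ +-distrib-/-∣ʳ (suc d) (n∣m*n x) ⟩
    suc d / 10 + x * 10 / 10   ≡⟨ cong₂ _+_ (m<n⇒m/n≡0 d<10) (m*n/n≡m x 10) ⟩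
    x                          ∎
  remainder : suc (10 * x + d) % 10 ≡ suc d
  remainder = trans (%-congˡ {o = 10} shape) (trans ([m+kn]%n≡m%n (suc d) x 10) (m<n⇒m%n≡m d<10))

NonzeroDigit : ℕ → Set
NonzeroDigit d = 0 < d × d < 10

digits-fromDigits : ∀ {ds} → All NonzeroDigit ds → digits (fromDigits ds) ≡ ds
digits-fromDigits {ds} = go (reverseView ds)
  where
  go : ∀ {ds} → Reverse ds → All NonzeroDigit ds → digits (fromDigits ds) ≡ ds
  go []              _     = refl
  go (xs ∶ rs ∶ʳ x) valid with ∷ʳ⁻ valid
  ... | valid-xs , (0<x , x<10) = begin
    digits (fromDigits (xs ∷ʳ x))      ≡⟨ cong digits (foldl-∷ʳ pushDigit 0 x xs) ⟩
    digits (10 * fromDigits xs + x)    ≡⟨ digits-snoc (fromDigits xs) 0<x x<10 ⟩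
    digits (fromDigits xs) ∷ʳ x        ≡⟨ cong (_∷ʳ x) (go rs valid-xs) ⟩
    xs ∷ʳ x                            ∎
    where open ≡-Reasoning

replicate-++ : ∀ {X : Set} j k (x : X) → replicate (j + k) x ≡ replicate j x ++ replicate k x
replicate-++ zero    k x = refl
replicate-++ (suc j) k x = cong (x ∷_) (replicate-++ j k x)

B≡fromDigits : ∀ n a b → B (suc n) a b ≡ fromDigits (replicate n a ∷ʳ b)
B≡fromDigits n a b = begin
  a * A (suc n) + b ∸ a                         ≡⟨ cong (λ r → a * r + b ∸ a) (A≡repunit (suc n)) ⟩
  a * repunit (suc n) + b ∸ a                   ≡⟨ cong (λ r → r + b ∸ a) (fromDigits-replicate (suc n) a) ⟨
  fromDigits (replicate (suc n) a) + b ∸ a      ≡⟨ cong (λ ds → fromDigits ds + b ∸ a) replicate-snoc ⟩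
  fromDigits (replicate n a ∷ʳ a) + b ∸ a
    ≡⟨ cong (λ r → r + b ∸ a) (foldl-∷ʳ pushDigit 0 a (replicate n a)) ⟩
  10 * f + a + b ∸ a                            ≡⟨ cong (_∸ a) (swap (10 * f) a b) ⟩
  10 * f + b + a ∸ a                            ≡⟨ m+n∸n≡m (10 * f + b) a ⟩
  10 * f + b                                    ≡⟨ foldl-∷ʳ pushDigit 0 b (replicate n a) ⟨
  fromDigits (replicate n a ∷ʳ b)               ∎
  where
  open ≡-Reasoning
  f : ℕ
  f = fromDigits (replicate n a)
  replicate-snoc : replicate (suc n) a ≡ replicate n a ∷ʳ a
  replicate-snoc = trans (cong (λ m → replicate m a) (+-comm 1 n)) (replicate-++ n 1 a)
  swap : ∀ x a b → x + a + b ≡ x + b + a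
  swap = solve-∀

digits-B : ∀ n {a b} → NonzeroDigit a → NonzeroDigit b → digits (B (suc n) a b) ≡ replicate n a ∷ʳ b
digits-B n {a} {b} a-digit b-digit =
  trans (cong digits (B≡fromDigits n a b)) (digits-fromDigits (∷ʳ⁺ (replicate⁺ n a-digit) b-digit))

rearrangement : (j k a b : ℕ) → List ℕ
rearrangement j k a b = replicate j a ++ b ∷ replicate k a

rearrangement-↭ : ∀ j k {n} a b → j + k ≡ n → rearrangement j k a b ↭ replicate n a ∷ʳ b
rearrangement-↭ j k a b refl = begin
  replicate j a ++ b ∷ replicate k a   ↭⟨ shift b (replicate j a) (replicate k a) ⟩
  b ∷ replicate j a ++ replicate k a   ≡⟨ cong (b ∷_) (replicate-++ j k a) ⟨
  b ∷ replicate (j + k) a              ↭⟨ ∷↭∷ʳ b (replicate (j + k) a) ⟩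
  replicate (j + k) a ∷ʳ b             ∎
  where open PermutationReasoning

fromDigits-rearrangement : ∀ j k {n} a b → j + k ≡ n →
  fromDigits (rearrangement j k a b) + a * 10 ^ k ≡ a * repunit (suc n) + b * 10 ^ k
fromDigits-rearrangement j k a b refl = begin
  fromDigits (replicate j a ++ b ∷ replicate k a) + a * 10 ^ k
    ≡⟨ cong (λ l → fromDigits (replicate j a ++ b ∷ replicate k a) + a * 10 ^ l) (length-replicate k) ⟨
  fromDigits (replicate j a ++ b ∷ replicate k a) + a * 10 ^ length (replicate k a)
    ≡⟨ fromDigits-replaceDigit (replicate j a) a b (replicate k a) ⟩
  fromDigits (replicate j a ++ a ∷ replicate k a) + b * 10 ^ length (replicate k a)
    ≡⟨ cong₂ (λ ds l → fromDigits ds + b * 10 ^ l) (sym (replicate-++ j (suc k) a)) (length-replicate k) ⟩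
  fromDigits (replicate (j + suc k) a) + b * 10 ^ k
    ≡⟨ cong (λ l → fromDigits (replicate l a) + b * 10 ^ k) (+-suc j k) ⟩
  fromDigits (replicate (suc (j + k)) a) + b * 10 ^ k
    ≡⟨ cong (_+ b * 10 ^ k) (fromDigits-replicate (suc (j + k)) a) ⟩
  a * repunit (suc (j + k)) + b * 10 ^ k
    ∎
  where open ≡-Reasoning

repunit-≤-rearrangement : ∀ j k {n a b} → j + k ≡ n → 1 ≤ a → 1 ≤ b →
  repunit (suc n) ≤ fromDigits (rearrangement j k a b)
repunit-≤-rearrangement j k {a = a} {b} refl 1≤a 1≤b =
  subst (λ l → repunit l ≤ fromDigits (rearrangement j k a b)) digit-count
    (repunit-≤-fromDigits (++⁺ (replicate⁺ j 1≤a) (1≤b ∷ replicate⁺ k 1≤a)))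
  where
  digit-count : length (rearrangement j k a b) ≡ suc (j + k)
  digit-count = begin
    length (replicate j a ++ b ∷ replicate k a)          ≡⟨ length-++ (replicate j a) ⟩
    length (replicate j a) + suc (length (replicate k a))
      ≡⟨ cong₂ (λ x y → x + suc y) (length-replicate j) (length-replicate k) ⟩
    j + suc k                                            ≡⟨ +-suc j k ⟩
    suc (j + k)                                          ∎
    where open ≡-Reasoning

rearrangement-indivisible : ∀ {n a b} → AbsolutePrime (B (suc n) a b) →
  NonzeroDigit a → NonzeroDigit b → 1 ≤ n →
  ∀ j k → j + k ≡ n → ∀ {d} → 1 < d → d ≤ suc n → d ∤ fromDigits (rearrangement j k a b)
rearrangement-indivisible {n} {a} {b} (_ , permutations-prime) a-digit b-digit 1≤n j k j+k≡n {d} 1<d d≤1+n d∣X =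
  Prime.notComposite X-prime (hasNonTrivialDivisor {{n>1⇒nonTrivial 1<d}} d<X d∣X)
  where
  X : ℕ
  X = fromDigits (rearrangement j k a b)
  X-prime : Prime X
  X-prime = permutations-prime (rearrangement j k a b) (begin
    rearrangement j k a b          ↭⟨ rearrangement-↭ j k a b j+k≡n ⟩
    replicate n a ∷ʳ b             ≡⟨ digits-B n a-digit b-digit ⟨
    digits (B (suc n) a b)         ∎)
    where open PermutationReasoning
  d<X : d < X
  d<X = begin-strict
    d                      ≤⟨ d≤1+n ⟩
    suc n                  <⟨ n<repunit (s≤s 1≤n) ⟩
    repunit (suc n)        ≤⟨ repunit-≤-rearrangement j k j+k≡n (proj₁ a-digit) (proj₁ b-digit) ⟩
    X                      ∎
    where open ≤-Reasoning

%≡%⇒∣∸ : ∀ x y d .{{_ : NonZero d}} → x % d ≡ y % d → d ∣ x ∸ y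
%≡%⇒∣∸ x y d x≡y = divides (x / d ∸ y / d) (begin
  x ∸ y                                       ≡⟨ cong₂ _∸_ (m≡m%n+[m/n]*n x d) (m≡m%n+[m/n]*n y d) ⟩
  (x % d + x / d * d) ∸ (y % d + y / d * d)   ≡⟨ cong (λ r → (x % d + x / d * d) ∸ (r + y / d * d)) x≡y ⟨
  (x % d + x / d * d) ∸ (x % d + y / d * d)   ≡⟨ [m+n]∸[m+o]≡n∸o (x % d) (x / d * d) (y / d * d) ⟩
  x / d * d ∸ y / d * d                       ≡⟨ *-distribʳ-∸ d (x / d) (y / d) ⟨
  (x / d ∸ y / d) * d                         ∎)
  where open ≡-Reasoning

%≡%⇒∣∣-∣ : ∀ x y d .{{_ : NonZero d}} → x % d ≡ y % d → d ∣ ∣ x - y ∣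
%≡%⇒∣∣-∣ x y d x≡y with ∣m-n∣≡[m∸n]∨[n∸m] x y
... | inj₁ ∣x-y∣≡x∸y = subst (d ∣_) (sym ∣x-y∣≡x∸y) (%≡%⇒∣∸ x y d x≡y)
... | inj₂ ∣x-y∣≡y∸x = subst (d ∣_) (sym ∣x-y∣≡y∸x) (%≡%⇒∣∸ y x d (sym x≡y))

∣∸⇒%≡% : ∀ {x y} d .{{_ : NonZero d}} → y ≤ x → d ∣ x ∸ y → x % d ≡ y % d
∣∸⇒%≡% {x} {y} d y≤x d∣x∸y = trans (cong (_% d) (sym (m∸n+n≡m y≤x))) (%-remove-+ˡ y d∣x∸y)

*-%≡1 : ∀ y {x} d .{{_ : NonZero d}} → x % d ≡ 1 % d → (y * x) % d ≡ y % d
*-%≡1 y {x} d x≡1 = begin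
  (y * x) % d                  ≡⟨ %-distribˡ-* y x d ⟩
  ((y % d) * (x % d)) % d      ≡⟨ cong (λ r → ((y % d) * r) % d) x≡1 ⟩
  ((y % d) * (1 % d)) % d      ≡⟨ %-distribˡ-* y 1 d ⟨
  (y * 1) % d                  ≡⟨ cong (_% d) (*-identityʳ y) ⟩
  y % d                        ∎
  where open ≡-Reasoning

^-%≡1 : ∀ {x} q d .{{_ : NonZero d}} → x % d ≡ 1 % d → x ^ q % d ≡ 1 % d
^-%≡1       zero    d x≡1 = refl
^-%≡1 {x} (suc q) d x≡1 = trans (*-%≡1 x d (^-%≡1 q d x≡1)) x≡1

module _ {p} (p-prime : Prime p) where

  private instance
    p-nonZero : NonZero p
    p-nonZero = prime⇒nonZero p-prime

  ∤∧∣*⇒∣ : ∀ {c x} → p ∤ c → p ∣ c * x → p ∣ x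
  ∤∧∣*⇒∣ {c} {x} p∤c p∣cx =
    [ (λ p∣c → contradiction p∣c p∤c) , id ]′ (euclidsLemma c x p-prime p∣cx)

  ∤-* : ∀ {x y} → p ∤ x → p ∤ y → p ∤ x * y
  ∤-* p∤x p∤y = p∤y ∘ ∤∧∣*⇒∣ p∤x

  ∤1 : p ∤ 1
  ∤1 p∣1 = <⇒≢ (nonTrivial⇒n>1 p {{prime⇒nonTrivial p-prime}}) (sym (∣1⇒≡1 p∣1))

  ∤-^ : ∀ {x} → p ∤ x → ∀ i → p ∤ x ^ i
  ∤-^ p∤x zero    = ∤1
  ∤-^ p∤x (suc i) = ∤-* p∤x (∤-^ p∤x i)

  *-cancelˡ-%-≤ : ∀ {c x y} → p ∤ c → y ≤ x → (c * x) % p ≡ (c * y) % p → x % p ≡ y % p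
  *-cancelˡ-%-≤ {c} {x} {y} p∤c y≤x cx≡cy = ∣∸⇒%≡% p y≤x (∤∧∣*⇒∣ p∤c p∣c[x∸y])
    where
    p∣c[x∸y] : p ∣ c * (x ∸ y)
    p∣c[x∸y] = subst (p ∣_) (sym (*-distribˡ-∸ c x y)) (%≡%⇒∣∸ (c * x) (c * y) p cx≡cy)

  *-cancelˡ-% : ∀ {c x y} → p ∤ c → (c * x) % p ≡ (c * y) % p → x % p ≡ y % p
  *-cancelˡ-% {c} {x} {y} p∤c cx≡cy with ≤-total y x
  ... | inj₁ y≤x = *-cancelˡ-%-≤ p∤c y≤x cx≡cy
  ... | inj₂ x≤y = sym (*-cancelˡ-%-≤ p∤c x≤y (sym cx≡cy))

injective⇒surjective : ∀ {n} {f : Fin n → Fin n} → Injective _≡_ _≡_ f → StrictlySurjective _≡_ f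
injective⇒surjective {suc n} {f} f-injective y with any? (λ x → f x Fin.≟ y)
... | yes hit = hit
... | no  miss = contradiction (injective⇒≤ punched-injective) 1+n≰n
  where
  y∉image : ∀ x → y ≢ f x
  y∉image x y≡fx = miss (x , sym y≡fx)
  punched : Fin (suc n) → Fin n
  punched x = punchOut (y∉image x)
  punched-injective : Injective _≡_ _≡_ punched
  punched-injective {x} {x′} = f-injective ∘ punchOut-injective (y∉image x) (y∉image x′)

injective⇒hits-all-but : ∀ {m} {f : Fin m → Fin (suc m)} (i : Fin (suc m)) → Injective _≡_ _≡_ f →
  (∀ k → i ≢ f k) → ∀ j → i ≢ j → ∃ λ k → f k ≡ j
injective⇒hits-all-but {m} {f} i f-injective i∉image j i≢j =
  let k , gk≡j = injective⇒surjective g-injective (punchOut i≢j)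
  in k , punchOut-injective (i∉image k) i≢j gk≡j
  where
  g : Fin m → Fin m
  g k = punchOut (i∉image k)
  g-injective : Injective _≡_ _≡_ g
  g-injective {k} {k′} = f-injective ∘ punchOut-injective (i∉image k) (i∉image k′)

oddDigits : List ℕ
oddDigits = 1 ∷ 3 ∷ 7 ∷ 9 ∷ []

oddDigit⇒nonzeroDigit : ∀ {a} → a ∈ oddDigits → NonzeroDigit a
oddDigit⇒nonzeroDigit = All.lookup (from-yes (All.all? (λ d → 0 <? d ×-dec d <? 10) oddDigits))

oddDigit-gap-∣24 : ∀ {a b} → a ∈ oddDigits → b ∈ oddDigits → a ≢ b → ∣ a - b ∣ ∣ 24
oddDigit-gap-∣24 a∈ b∈ a≢b =
  [ (λ a≡b → contradiction a≡b a≢b) , id ]′ (All.lookup (All.lookup gaps a∈) b∈)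
  where
  gaps : All (λ a → All (λ b → a ≡ b ⊎ ∣ a - b ∣ ∣ 24) oddDigits) oddDigits
  gaps = from-yes (All.all? (λ a → All.all? (λ b → a ≟ b ⊎-dec ∣ a - b ∣ ∣? 24) oddDigits) oddDigits)

module PrimitiveRoot {m} (p-prime : Prime (suc m)) (root : TenPrimitiveRoot (suc m)) where

  private
    p : ℕ
    p = suc m

    1<p : 1 < p
    1<p = nonTrivial⇒n>1 p {{prime⇒nonTrivial p-prime}}

    instance
      m-nonZero : NonZero m
      m-nonZero = >-nonZero (s≤s⁻¹ 1<p)

  order-minimal : ∀ {h} → 10 ^ h % p ≡ 1 % p → h < m → h ≡ 0
  order-minimal {zero}  _     _   = refl
  order-minimal {suc h} 10ʰ≡1 h<m = contradiction 10ʰ≡1 (proj₂ root (suc h) z<s h<m)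

  order-divides : ∀ n → 10 ^ n % p ≡ 1 % p → m ∣ n
  order-divides n 10ⁿ≡1 = m%n≡0⇒n∣m n m (order-minimal 10ʳ≡1 (m%n<n n m))
    where
    r q : ℕ
    r = n % m
    q = n / m
    10ʳ≡1 : 10 ^ r % p ≡ 1 % p
    10ʳ≡1 = begin
      10 ^ r % p                       ≡⟨ *-%≡1 (10 ^ r) p (^-%≡1 q p (proj₁ root)) ⟨
      (10 ^ r * (10 ^ m) ^ q) % p      ≡⟨ cong (λ e → (10 ^ r * e) % p) (^-*-assoc 10 m q) ⟩
      (10 ^ r * 10 ^ (m * q)) % p      ≡⟨ cong (_% p) (^-distribˡ-+-* 10 r (m * q)) ⟨
      10 ^ (r + m * q) % p             ≡⟨ cong (λ e → 10 ^ (r + e) % p) (*-comm m q) ⟩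
      10 ^ (r + q * m) % p             ≡⟨ cong (λ e → 10 ^ e % p) (m≡m%n+[m/n]*n n m) ⟨
      10 ^ n % p                       ≡⟨ 10ⁿ≡1 ⟩
      1 % p                            ∎
      where open ≡-Reasoning

  p∤10 : p ∤ 10
  p∤10 p∣10 = ∤1 p-prime (m%n≡0⇒n∣m 1 p (trans (sym (proj₁ root)) (n∣m⇒m%n≡0 (10 ^ m) p p∣10^m)))
    where
    p∣10^m : p ∣ 10 ^ m
    p∣10^m = subst (λ e → p ∣ 10 ^ e) (suc-pred m) (∣-trans p∣10 (m∣m*n (10 ^ pred m)))

  p≢3 : p ≢ 3
  p≢3 refl = proj₂ root 1 z<s (s≤s z<s) refl

  p∤24 : p ∤ 24
  p∤24 = ∤-* p-prime (∤-^ p-prime p∤2 3) p∤3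
    where
    p∤2 : p ∤ 2
    p∤2 p∣2 = p∤10 (∣-trans p∣2 (divides 5 refl))
    p∤3 : p ∤ 3
    p∤3 p∣3 = [ (λ p≡1 → ∤1 p-prime (subst (_∣ 1) (sym p≡1) ∣-refl)) , p≢3 ]′
      (prime⇒irreducible (from-yes (prime? 3)) p∣3)

  10^-injective-≤ : ∀ {i j} → i ≤ j → j < m → 10 ^ i % p ≡ 10 ^ j % p → i ≡ j
  10^-injective-≤ {i} {j} i≤j j<m 10ⁱ≡10ʲ = begin
    i           ≡⟨ +-identityʳ i ⟨
    i + 0       ≡⟨ cong (i +_) (order-minimal (sym 10ʰ≡1) (≤-<-trans (m∸n≤m j i) j<m)) ⟨
    i + h       ≡⟨ m+[n∸m]≡n i≤j ⟩
    j           ∎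
    where
    open ≡-Reasoning
    h : ℕ
    h = j ∸ i
    10ʰ≡1 : 1 % p ≡ 10 ^ h % p
    10ʰ≡1 = *-cancelˡ-% p-prime (∤-^ p-prime p∤10 i) (begin
      (10 ^ i * 1) % p       ≡⟨ cong (_% p) (*-identityʳ (10 ^ i)) ⟩
      10 ^ i % p             ≡⟨ 10ⁱ≡10ʲ ⟩
      10 ^ j % p             ≡⟨ cong (λ e → 10 ^ e % p) (m+[n∸m]≡n i≤j) ⟨
      10 ^ (i + h) % p       ≡⟨ cong (_% p) (^-distribˡ-+-* 10 i h) ⟩
      (10 ^ i * 10 ^ h) % p  ∎)

  10^-injective : ∀ {i j} → i < m → j < m → 10 ^ i % p ≡ 10 ^ j % p → i ≡ j
  10^-injective {i} {j} i<m j<m 10ⁱ≡10ʲ with ≤-total i j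
  ... | inj₁ i≤j = 10^-injective-≤ i≤j j<m 10ⁱ≡10ʲ
  ... | inj₂ j≤i = sym (10^-injective-≤ j≤i i<m (sym 10ⁱ≡10ʲ))

  -- The p - 1 residues of c 10^k (k < p - 1) are distinct and nonzero, so they are all nonzero residues.
  c*10^k-onto-units : ∀ {c x} → p ∤ c → p ∤ x → ∃ λ k → k < m × (c * 10 ^ k) % p ≡ x % p
  c*10^k-onto-units {c} {x} p∤c p∤x =
    let k , fk≡x = injective⇒hits-all-but zero f-injective zero∉image (x mod p) (nonzero p∤x)
    in toℕ k , toℕ<n k , mod≡⇒%≡ (c * 10 ^ toℕ k) x fk≡x
    where
    toℕ-mod : ∀ y → toℕ (y mod p) ≡ y % p
    toℕ-mod y = toℕ-fromℕ< (m%n<n y p)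
    mod≡⇒%≡ : ∀ y z → y mod p ≡ z mod p → y % p ≡ z % p
    mod≡⇒%≡ y z y≡z = trans (sym (toℕ-mod y)) (trans (cong toℕ y≡z) (toℕ-mod z))
    f : Fin m → Fin p
    f k = (c * 10 ^ toℕ k) mod p
    nonzero : ∀ {y} → p ∤ y → zero ≢ y mod p
    nonzero {y} p∤y 0≡y = p∤y (m%n≡0⇒n∣m y p (sym (mod≡⇒%≡ 0 y 0≡y)))
    zero∉image : ∀ k → zero ≢ f k
    zero∉image k = nonzero (∤-* p-prime p∤c (∤-^ p-prime p∤10 (toℕ k)))
    f-injective : Injective _≡_ _≡_ f
    f-injective {i} {j} fi≡fj =
      toℕ-injective (10^-injective (toℕ<n i) (toℕ<n j)
        (*-cancelˡ-% p-prime p∤c (mod≡⇒%≡ (c * 10 ^ toℕ i) (c * 10 ^ toℕ j) fi≡fj)))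

  -- c = a + (p - 1) b is a - b modulo p, so X + c 10^k ≡ N whenever X + a 10^k = N + b 10^k.
  digit-change-divisible : ∀ {a b N} → a % p ≢ b % p → p ∤ N →
    ∃ λ k → k < m × ∀ {X} → X + a * 10 ^ k ≡ N + b * 10 ^ k → p ∣ X
  digit-change-divisible {a} {b} {N} a≢b p∤N =
    let k , k<m , ck≡N = c*10^k-onto-units p∤c p∤N in k , k<m , divisible k ck≡N
    where
    c : ℕ
    c = a + m * b
    p∤c : p ∤ c
    p∤c p∣c = a≢b (begin
      a % p                 ≡⟨ [m+kn]%n≡m%n a b p ⟨
      (a + b * p) % p       ≡⟨ cong (_% p) (shape a b m) ⟩
      (c + b) % p           ≡⟨ %-distribˡ-+ c b p ⟩
      (c % p + b % p) % p   ≡⟨ cong (λ r → (r + b % p) % p) (n∣m⇒m%n≡0 c p p∣c) ⟩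
      b % p % p             ≡⟨ m%n%n≡m%n b p ⟩
      b % p                 ∎)
      where
      open ≡-Reasoning
      shape : ∀ a b m → a + b * (1 + m) ≡ a + m * b + b
      shape = solve-∀
    divisible : ∀ k → (c * 10 ^ k) % p ≡ N % p → ∀ {X} → X + a * 10 ^ k ≡ N + b * 10 ^ k → p ∣ X
    divisible k ck≡N {X} X≡N = subst (p ∣_) (m+n∸n≡m X (c * t)) (%≡%⇒∣∸ (X + c * t) (c * t) p (begin
      (X + c * t) % p          ≡⟨ cong (_% p) X+ct≡N+btp ⟩
      (N + b * t * p) % p      ≡⟨ [m+kn]%n≡m%n N (b * t) p ⟩
      N % p                    ≡⟨ ck≡N ⟨
      (c * t) % p              ∎))
      where
      open ≡-Reasoning
      t : ℕ
      t = 10 ^ k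
      X+ct≡N+btp : X + c * t ≡ N + b * t * p
      X+ct≡N+btp = begin
        X + (a + m * b) * t          ≡⟨ split X a m b t ⟩
        X + a * t + m * b * t        ≡⟨ cong (_+ m * b * t) X≡N ⟩
        N + b * t + m * b * t        ≡⟨ collect N b t m ⟩
        N + b * t * (1 + m)          ∎
        where
        split : ∀ X a m b t → X + (a + m * b) * t ≡ X + a * t + m * b * t
        split = solve-∀
        collect : ∀ N b t m → N + b * t + m * b * t ≡ N + b * t * (1 + m)
        collect = solve-∀

  repunit-order : ∀ n → p ∣ repunit n → m ∣ n
  repunit-order n p∣Rₙ = order-divides n (begin
    10 ^ n % p                 ≡⟨ cong (_% p) (9*repunit+1≡10^n n) ⟨
    (9 * repunit n + 1) % p    ≡⟨ %-remove-+ˡ 1 (∣n⇒∣m*n 9 p∣Rₙ) ⟩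
    1 % p                      ∎)
    where open ≡-Reasoning

  oddDigits-incongruent : ∀ {a b} → a ∈ oddDigits → b ∈ oddDigits → a ≢ b → a % p ≢ b % p
  oddDigits-incongruent {a} {b} a∈ b∈ a≢b a≡b =
    p∤24 (∣-trans (%≡%⇒∣∣-∣ a b p a≡b) (oddDigit-gap-∣24 a∈ b∈ a≢b))

  absolutePrime⇒∣a*repunit : ∀ {a b n} → a ∈ oddDigits → b ∈ oddDigits → a ≢ b → 1 ≤ n → m < suc n →
    AbsolutePrime (B (suc n) a b) → p ∣ a * repunit (suc n)
  absolutePrime⇒∣a*repunit {a} {b} {n} a∈ b∈ a≢b 1≤n m<1+n B-absolute with p ∣? a * repunit (suc n)
  ... | yes p∣N = p∣N
  ... | no  p∤N =
    let k , k<m , p∣changed = digit-change-divisible {a} {b} (oddDigits-incongruent a∈ b∈ a≢b) p∤N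
        j+k≡n : n ∸ k + k ≡ n
        j+k≡n = m∸n+n≡m (≤-trans (<⇒≤ k<m) (s≤s⁻¹ m<1+n))
    in contradiction (p∣changed (fromDigits-rearrangement (n ∸ k) k a b j+k≡n))
         (rearrangement-indivisible B-absolute (oddDigit⇒nonzeroDigit a∈) (oddDigit⇒nonzeroDigit b∈) 1≤n
            (n ∸ k) k j+k≡n 1<p m<1+n)

lemma6 : ∀ (a b n p : ℕ) → a ∈ (1 ∷ 3 ∷ 7 ∷ 9 ∷ []) → b ∈ (1 ∷ 3 ∷ 7 ∷ 9 ∷ []) → ¬ (a ≡ b)
         → 2 ≤ n → AbsolutePrime (B n a b)
         → .{{_ : NonZero p}} → Prime p → p ∸ 1 < n → TenPrimitiveRoot p → gcd a p ≡ 1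
         → (p ∸ 1) ∣ n
lemma6 _ _ _ zero _ _ _ _ _ p-prime = contradiction refl (≢-nonZero⁻¹ 0 {{prime⇒nonZero p-prime}})
lemma6 a b (suc n) (suc m) a∈ b∈ a≢b 2≤1+n B-absolute p-prime m<1+n root gcd[a,p]≡1 =
  repunit-order (suc n)
    (coprime-divisor p⊥a (absolutePrime⇒∣a*repunit a∈ b∈ a≢b (s≤s⁻¹ 2≤1+n) m<1+n B-absolute))
  where
  open PrimitiveRoot p-prime root
  p⊥a : Coprime.Coprime (suc m) a
  p⊥a = Coprime.sym (gcd≡1⇒coprime {a} gcd[a,p]≡1)
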